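{- Let $w$ be a $1$-$2$ occurrence word. Then $w$ has property (Q) if and only if one of the following holds: (1) $w$ is empty; (2) $w=w'\,a$ where $a$ is an unmatched symbol of $w$ and $w'$ has property (Q); (3) $w=w_1\,a\,w_2\,a$ where no unmatched symbol of $w$ occurs in $w_2$, $w_2^\circ$ has property (P), and $w_1$ has property (Q). Moreover, such a decomposition, if it exists, is unique.
   Context: A $1$-$2$ occurrence word is a word in which each symbol occurs once or twice; symbols occurring once are unmatched, those occurring twice are matched. $w^\circ$ is the double occurrence word obtained from $w$ by deleting its unmatched symbols. For a word $w$, $\vec\Lambda(w)$ is the directed graph on the matched symbols of $w$ with an arc $e\to f$ whenever $e\,f\,e\,f$ is a subsequence of $w$ (one says $e$ is interlaced on the right by $f$); a sink is a matched symbol with no out-neighbor. An unmatched symbol $a$ is covered by a matched symbol $b$ if $b\,a\,b$ is a subsequence of $w$. Property (P): $w$ is a double occurrence word and the set of sinks of $\vec\Lambda(w)$ is dominating, i.e. every non-sink has an out-neighbor that is a sink. Property (Q): $w$ is a $1$-$2$ occurrence word, $w^\circ$ has property (P), and no unmatched symbol of $w$ is covered in $w$ by a sink of $\vec\Lambda(w)$. (Subwords such as $w_1,w_2$ are regarded as $1$-$2$ occurrence words on their own, so a symbol matched in $w$ may be unmatched in $w_1$.) -}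

module Defs where

open import Data.Nat using (ℕ; zero; suc; _≟_)
open import Data.List using (List; []; _∷_; _++_; [_]; filter)
open import Data.List.Membership.Propositional using (_∈_; _∉_)
open import Data.List.Relation.Binary.Sublist.Propositional using (_⊆_)
open import Data.Product using (Σ; _×_; ∃; ∃-syntax)
open import Data.Sum using (_⊎_)
open import Data.Empty using (⊥)
open import Relation.Nullary using (¬_; yes; no)
open import Relation.Binary.PropositionalEquality using (_≡_)

Word : Set
Word = List ℕ

occ : ℕ → Word → ℕ
occ a [] = zero
occ a (x ∷ w) with x ≟ a
... | yes _ = suc (occ a w)
... | no  _ = occ a w

Matched : Word → ℕ → Set
Matched w a = occ a w ≡ 2

Unmatched : Word → ℕ → Set
Unmatched w a = occ a w ≡ 1

OneTwo : Word → Set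
OneTwo w = ∀ a → a ∈ w → Unmatched w a ⊎ Matched w a

DOW : Word → Set
DOW w = ∀ a → a ∈ w → Matched w a

_° : Word → Word
w ° = filter (λ a → occ a w ≟ 2) w

-- arc e → f in the directed interlacement graph Λ⃗(w):
-- e, f matched symbols of w and  e f e f  a subsequence of w
Arc : Word → ℕ → ℕ → Set
Arc w e f = Matched w e × Matched w f × (e ∷ f ∷ e ∷ f ∷ []) ⊆ w

Sink : Word → ℕ → Set
Sink w e = Matched w e × (∀ f → ¬ Arc w e f)

P : Word → Set
P w = DOW w × (∀ e → Matched w e → ¬ Sink w e → ∃[ f ] (Arc w e f × Sink w f))

Covers : Word → ℕ → ℕ → Set
Covers w b a = (b ∷ a ∷ b ∷ []) ⊆ w

Q : Word → Set
Q w = OneTwo w × P (w °) × (∀ a b → Unmatched w a → Sink w b → ¬ Covers w b a)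

data Shape : Set where
  empty : Shape
  snoc  : (w' : Word) (a : ℕ) → Shape
  wrap  : (w₁ : Word) (a : ℕ) (w₂ : Word) → Shape

IsDecomp : Word → Shape → Set
IsDecomp w empty = w ≡ []
IsDecomp w (snoc w' a) = (w ≡ w' ++ [ a ]) × Unmatched w a × Q w'
IsDecomp w (wrap w₁ a w₂) =
  (w ≡ w₁ ++ (a ∷ w₂ ++ [ a ])) × (∀ b → Unmatched w b → b ∉ w₂) × P (w₂ °) × Q w₁

-- Split w at its last letter x.  If x is unmatched, deleting it changes neither the
-- interlacement graph nor the covering of unmatched symbols by sinks, so (Q) passes
-- between w and the rest.  If x is matched, w = w₁ x w₂ x and x is a sink that covers
-- everything in w₂; a symbol occurring once in w₁ and once in w₂ has an arc to x; arcs
-- out of symbols matched in w₂ stay in w₂; and an arc out of a symbol e matched in w₁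
-- either stays in w₁ or ends at a symbol occurring once in w₁ and covered there by e.
-- Hence the sinks of w are dominating and cover no unmatched symbol exactly when w₂
-- has no unmatched symbol, w₂° has (P) and w₁ has (Q).  The case and the factors are
-- determined by the last letter x, whether it is matched, and its other occurrence.
module Submission where

open import Defs
open import Data.Empty using (⊥; ⊥-elim)
open import Data.Nat using (ℕ; zero; suc; pred; _+_; _≤_; _<_; z≤n; s≤s; s≤s⁻¹; _≟_)
open import Data.Nat.Properties using (≤-refl; ≤-antisym; ≤-trans; m≤n⇒m≤1+n; +-identityʳ)
open import Data.List using ([]; _∷_; _++_; [_]; filter; replicate)
open import Data.List.Properties using (++-assoc; ∷-injective; ∷ʳ-injective; ++-conicalʳ; filter-all)
open import Data.List.Membership.Propositional using (_∈_; _∉_)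
open import Data.List.Membership.Propositional.Properties using (∈-∃++; ∈-++⁺ʳ; ∈-++⁻; ∈-filter⁻)
open import Data.List.Membership.DecPropositional _≟_ using (_∈?_)
open import Data.List.Relation.Unary.Any using (here; there)
open import Data.List.Relation.Unary.All using ([]; _∷_)
open import Data.List.Relation.Binary.Sublist.Propositional using (_⊆_; []; _∷_; _∷ʳ_; ⊆-refl; ⊆-trans; minimum; from∈; to∈)
open import Data.List.Relation.Binary.Sublist.Propositional.Properties using (Any-resp-⊆; ++⁺; ++⁺ˡ; ++⁺ʳ; ∷ˡ⁻; filter-⊆; filter⁺)
open import Data.List.Reverse using (Reverse; reverseView; []; _∶_∶ʳ_)
open import Data.Product using (_×_; ∃-syntax; _,_; proj₁; proj₂)
open import Data.Sum using (_⊎_; inj₁; inj₂)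
open import Function.Base using (_∘_)
open import Function.Bundles using (_⇔_; mk⇔; Equivalence)
open import Relation.Binary.PropositionalEquality using (_≡_; _≢_; refl; sym; trans; cong; subst)
open import Relation.Nullary using (¬_; Dec; yes; no)

open Equivalence using (to; from)

occ-∷-≡ : ∀ a v → occ a (a ∷ v) ≡ suc (occ a v)
occ-∷-≡ a v with a ≟ a
... | yes _ = refl
... | no a≢a = ⊥-elim (a≢a refl)

occ-∷-≢ : ∀ {a x} v → x ≢ a → occ a (x ∷ v) ≡ occ a v
occ-∷-≢ {a} {x} v x≢a with x ≟ a
... | yes x≡a = ⊥-elim (x≢a x≡a)
... | no _ = refl

occ-++ : ∀ a u v → occ a (u ++ v) ≡ occ a u + occ a v
occ-++ a [] v = refl
occ-++ a (x ∷ u) v with x ≟ a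
... | yes _ = cong suc (occ-++ a u v)
... | no _ = occ-++ a u v

occ-++-[≢] : ∀ {a x} u → x ≢ a → occ a (u ++ [ x ]) ≡ occ a u
occ-++-[≢] {a} u x≢a = trans (occ-++ a u _) (trans (cong (occ a u +_) (occ-∷-≢ [] x≢a)) (+-identityʳ _))

occ-mono : ∀ a {p v} → p ⊆ v → occ a p ≤ occ a v
occ-mono a [] = z≤n
occ-mono a (y ∷ʳ τ) with y ≟ a
... | yes _ = m≤n⇒m≤1+n (occ-mono a τ)
... | no _ = occ-mono a τ
occ-mono a (_∷_ {x} refl τ) with x ≟ a
... | yes _ = s≤s (occ-mono a τ)
... | no _ = occ-mono a τ

occ-replicate : ∀ n a → occ a (replicate n a) ≡ n
occ-replicate zero a = refl
occ-replicate (suc n) a = trans (occ-∷-≡ a _) (cong suc (occ-replicate n a))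

replicate⊆⇒≤occ : ∀ n {a v} → replicate n a ⊆ v → n ≤ occ a v
replicate⊆⇒≤occ n {a} {v} τ = subst (_≤ occ a v) (occ-replicate n a) (occ-mono a τ)

≤occ⇒replicate⊆ : ∀ n {a} v → n ≤ occ a v → replicate n a ⊆ v
≤occ⇒replicate⊆ zero v _ = minimum v
≤occ⇒replicate⊆ (suc n) {a} (x ∷ v) le with x ≟ a
... | yes refl = refl ∷ ≤occ⇒replicate⊆ n v (s≤s⁻¹ le)
... | no _ = x ∷ʳ ≤occ⇒replicate⊆ (suc n) v le

∈⇒0<occ : ∀ {a v} → a ∈ v → 0 < occ a v
∈⇒0<occ τ = replicate⊆⇒≤occ 1 (from∈ τ)

occ≡suc⇒∈ : ∀ {a} v {n} → occ a v ≡ suc n → a ∈ v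
occ≡suc⇒∈ v eq = to∈ (≤occ⇒replicate⊆ 1 v (subst (0 <_) (sym eq) (s≤s z≤n)))

Matched⇒twice : ∀ {a} v → Matched v a → (a ∷ a ∷ []) ⊆ v
Matched⇒twice v m = ≤occ⇒replicate⊆ 2 v (subst (2 ≤_) (sym m) ≤-refl)

module _ {Keep : ℕ → Set} (keep? : ∀ a → Dec (Keep a)) where

  occ-filter : ∀ {e} v → Keep e → occ e (filter keep? v) ≡ occ e v
  occ-filter [] _ = refl
  occ-filter {e} (x ∷ v) pe with keep? x | x ≟ e
  ... | yes _ | yes refl = trans (occ-∷-≡ e _) (cong suc (occ-filter v pe))
  ... | yes _ | no x≢e = trans (occ-∷-≢ _ x≢e) (occ-filter v pe)
  ... | no ¬px | yes refl = ⊥-elim (¬px pe)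
  ... | no _ | no _ = occ-filter v pe

  occ-filter-∁ : ∀ {e} v → ¬ Keep e → occ e (filter keep? v) ≡ 0
  occ-filter-∁ [] _ = refl
  occ-filter-∁ {e} (x ∷ v) ¬pe with keep? x
  ... | no _ = occ-filter-∁ v ¬pe
  ... | yes px with x ≟ e
  ...   | yes refl = ⊥-elim (¬pe px)
  ...   | no _ = occ-filter-∁ v ¬pe

Unmatched⇒¬Matched : ∀ {w a} → Unmatched w a → ¬ Matched w a
Unmatched⇒¬Matched u m with trans (sym u) m
... | ()

m+n≡2⇒ : ∀ m n → m + n ≡ 2 → m ≡ 2 ⊎ (m ≡ 1 × n ≡ 1) ⊎ n ≡ 2
m+n≡2⇒ 0 n eq = inj₂ (inj₂ eq)
m+n≡2⇒ 1 n eq = inj₂ (inj₁ (refl , cong pred eq))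
m+n≡2⇒ 2 n eq = inj₁ refl
m+n≡2⇒ (suc (suc (suc m))) n ()

Matched-++⁻ : ∀ u {v a} → Matched (u ++ v) a →
  Matched u a ⊎ (Unmatched u a × Unmatched v a) ⊎ Matched v a
Matched-++⁻ u {v} {a} m = m+n≡2⇒ (occ a u) (occ a v) (trans (sym (occ-++ a u v)) m)

occ≤2 : ∀ {w a} → OneTwo w → a ∈ w → occ a w ≤ 2
occ≤2 {a = a} ot a∈w with ot a a∈w
... | inj₁ u = subst (_≤ 2) (sym u) (s≤s z≤n)
... | inj₂ m = subst (_≤ 2) (sym m) (s≤s (s≤s z≤n))

twice⇒Matched : ∀ {w a} → OneTwo w → (a ∷ a ∷ []) ⊆ w → Matched w a
twice⇒Matched ot τ = ≤-antisym (occ≤2 ot (Any-resp-⊆ τ (here refl))) (replicate⊆⇒≤occ 2 τ)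

¬thrice : ∀ {w a} → OneTwo w → ¬ (a ∷ a ∷ a ∷ []) ⊆ w
¬thrice ot τ with ≤-trans (replicate⊆⇒≤occ 3 τ) (occ≤2 ot (Any-resp-⊆ τ (here refl)))
... | s≤s (s≤s ())

Matched-⊆ : ∀ {v w a} → OneTwo w → v ⊆ w → Matched v a → Matched w a
Matched-⊆ {a = a} ot τ m =
  ≤-antisym (occ≤2 ot (Any-resp-⊆ τ (occ≡suc⇒∈ _ m))) (≤-trans (subst (2 ≤_) (sym m) ≤-refl) (occ-mono a τ))

Unmatched-⊆ : ∀ {v w a} → v ⊆ w → Unmatched w a → a ∈ v → Unmatched v a
Unmatched-⊆ {v} {a = a} τ u a∈v = ≤-antisym (subst (occ a v ≤_) u (occ-mono a τ)) (∈⇒0<occ a∈v)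

OneTwo-⊆ : ∀ {v w} → OneTwo w → v ⊆ w → OneTwo v
OneTwo-⊆ {v} ot τ a a∈v with ot a (Any-resp-⊆ τ a∈v)
... | inj₁ u = inj₁ (Unmatched-⊆ τ u a∈v)
... | inj₂ m = between (∈⇒0<occ a∈v) (subst (occ a v ≤_) m (occ-mono a τ))
  where
  between : ∀ {n} → 0 < n → n ≤ 2 → n ≡ 1 ⊎ n ≡ 2
  between {1} _ _ = inj₁ refl
  between {2} _ _ = inj₂ refl
  between {suc (suc (suc _))} _ (s≤s (s≤s ()))

⊆-++⁻ʳ-∉head : ∀ u {x : ℕ} {xs v} → x ∉ u → x ∷ xs ⊆ u ++ v → x ∷ xs ⊆ v
⊆-++⁻ʳ-∉head [] _ τ = τ
⊆-++⁻ʳ-∉head (y ∷ u) x∉ (_ ∷ʳ τ) = ⊆-++⁻ʳ-∉head u (x∉ ∘ there) τ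
⊆-++⁻ʳ-∉head (y ∷ u) x∉ (refl ∷ τ) = ⊥-elim (x∉ (here refl))

⊆-++⁻ˡ-∉last : ∀ xs u {x : ℕ} {v} → x ∉ v → xs ++ [ x ] ⊆ u ++ v → xs ++ [ x ] ⊆ u
⊆-++⁻ˡ-∉last xs [] x∉ τ = ⊥-elim (x∉ (Any-resp-⊆ τ (∈-++⁺ʳ xs (here refl))))
⊆-++⁻ˡ-∉last [] (y ∷ u) x∉ (_ ∷ʳ τ) = y ∷ʳ ⊆-++⁻ˡ-∉last [] u x∉ τ
⊆-++⁻ˡ-∉last [] (y ∷ u) x∉ (refl ∷ τ) = refl ∷ minimum u
⊆-++⁻ˡ-∉last xs@(_ ∷ _) (y ∷ u) x∉ (_ ∷ʳ τ) = y ∷ʳ ⊆-++⁻ˡ-∉last xs u x∉ τ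
⊆-++⁻ˡ-∉last (_ ∷ xs) (y ∷ u) x∉ (refl ∷ τ) = refl ∷ ⊆-++⁻ˡ-∉last xs u x∉ τ

last-has-no-successor : ∀ u {x y : ℕ} {ys} → x ∉ u → ¬ (x ∷ y ∷ ys) ⊆ u ++ [ x ]
last-has-no-successor u x∉u τ with ⊆-++⁻ʳ-∉head u x∉u τ
... | _ ∷ʳ ()
... | _ ∷ ()

-- The interlacement graph of a subword

SinksDominate : Word → Set
SinksDominate w = ∀ e → Matched w e → ¬ Sink w e → ∃[ f ] (Arc w e f × Sink w f)

NoSinkCoversUnmatched : Word → Set
NoSinkCoversUnmatched w = ∀ a b → Unmatched w a → Sink w b → ¬ Covers w b a

Q′ : Word → Set
Q′ w = OneTwo w × SinksDominate w × NoSinkCoversUnmatched w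

Arc-⊆ : ∀ {v w e f} → OneTwo w → v ⊆ w → Arc v e f → Arc w e f
Arc-⊆ ot τ (mₑ , m_f , σ) = Matched-⊆ ot τ mₑ , Matched-⊆ ot τ m_f , ⊆-trans σ τ

Sink-⊇ : ∀ {v w e} → OneTwo w → v ⊆ w → Sink w e → Matched v e → Sink v e
Sink-⊇ ot τ (_ , noArc) m = m , λ f → noArc f ∘ Arc-⊆ ot τ

ArcsToSinksReflect : Word → Word → Set
ArcsToSinksReflect v w = ∀ {e f} → Matched v e → Arc w e f → Sink w f → Arc v e f

module _ {v w} (ot : OneTwo w) (v⊆w : v ⊆ w) where

  SinksDominate-restrict : ArcsToSinksReflect v w → SinksDominate w → SinksDominate v
  SinksDominate-restrict reflect dom e m ¬sink
    with dom e (Matched-⊆ ot v⊆w m) (λ s → ¬sink (Sink-⊇ ot v⊆w s m))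
  ... | f , a , s = f , reflect m a s , Sink-⊇ ot v⊆w s (proj₁ (proj₂ (reflect m a s)))

  Sink-lift : ArcsToSinksReflect v w → SinksDominate w → ∀ {e} → Sink v e → Sink w e
  Sink-lift reflect dom {e} (m , noArc) = m′ , λ f a → noSinkArc (dom e m′ (λ s → proj₂ s f a))
    where
    m′ = Matched-⊆ ot v⊆w m
    noSinkArc : ¬ (∃[ f ] (Arc w e f × Sink w f))
    noSinkArc (f , a , s) = noArc f (reflect m a s)

  dominated-lift : (∀ {e} → Sink v e → Sink w e) → SinksDominate v →
    ∀ {e} → Matched v e → ¬ Sink w e → ∃[ f ] (Arc w e f × Sink w f)
  dominated-lift lift dom {e} m ¬sink with dom e m (¬sink ∘ lift)
  ... | f , a , s = f , Arc-⊆ ot v⊆w a , lift s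

record SameGraph (u v : Word) : Set where
  field
    matched : ∀ {e} → Matched u e ⇔ Matched v e
    arc     : ∀ {e f} → Arc u e f ⇔ Arc v e f

SameGraph-sym : ∀ {u v} → SameGraph u v → SameGraph v u
SameGraph-sym g = record { matched = mk⇔ (from matched) (to matched) ; arc = mk⇔ (from arc) (to arc) }
  where open SameGraph g

Sink-transfer : ∀ {u v e} → SameGraph u v → Sink u e → Sink v e
Sink-transfer g (m , noArc) = to matched m , λ f → noArc f ∘ from arc
  where open SameGraph g

SinksDominate-transfer : ∀ {u v} → SameGraph u v → SinksDominate u → SinksDominate v
SinksDominate-transfer g dom e m ¬sink =
  let (f , a , s) = dom e (from matched m) (¬sink ∘ Sink-transfer g) in f , to arc a , Sink-transfer g s
  where open SameGraph g

module _ (v : Word) where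

  private
    matched? : ∀ a → Dec (Matched v a)
    matched? a = occ a v ≟ 2

  Matched-° : ∀ {e} → Matched (v °) e ⇔ Matched v e
  Matched-° {e} = mk⇔ matched→ (λ m → trans (occ-filter matched? v m) m)
    where
    matched→ : Matched (v °) e → Matched v e
    matched→ m with matched? e
    ... | yes m′ = m′
    ... | no ¬m with trans (sym (occ-filter-∁ matched? v ¬m)) m
    ...   | ()

  SameGraph-° : SameGraph (v °) v
  SameGraph-° = record { matched = Matched-° ; arc = mk⇔ arc→ arc← }
    where
    arc→ : ∀ {e f} → Arc (v °) e f → Arc v e f
    arc→ (mₑ , m_f , σ) = to Matched-° mₑ , to Matched-° m_f , ⊆-trans σ (filter-⊆ matched? v)
    arc← : ∀ {e f} → Arc v e f → Arc (v °) e f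
    arc← {e} {f} (mₑ , m_f , σ) = from Matched-° mₑ , from Matched-° m_f ,
      subst (_⊆ v °) (filter-all matched? {e ∷ f ∷ e ∷ f ∷ []} (mₑ ∷ m_f ∷ mₑ ∷ m_f ∷ []))
        (filter⁺ matched? matched? (λ { refl m → m }) σ)

  P-°⇔SinksDominate : P (v °) ⇔ SinksDominate v
  P-°⇔SinksDominate = mk⇔
    (λ (_ , dom) → SinksDominate-transfer SameGraph-° dom)
    (λ dom → (λ a a∈v° → from Matched-° (proj₂ (∈-filter⁻ matched? {xs = v} a∈v°))) ,
             SinksDominate-transfer (SameGraph-sym SameGraph-°) dom)

Q⇔Q′ : ∀ {w} → Q w ⇔ Q′ w
Q⇔Q′ {w} = mk⇔ (λ (ot , p , nc) → ot , to (P-°⇔SinksDominate w) p , nc)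
               (λ (ot , dom , nc) → ot , from (P-°⇔SinksDominate w) dom , nc)

-- Deleting a final unmatched symbol

module Snoc (u : Word) (x : ℕ) (ot : OneTwo (u ++ [ x ])) (x-unmatched : Unmatched (u ++ [ x ]) x) where

  u⊆u++[x] : u ⊆ u ++ [ x ]
  u⊆u++[x] = ++⁺ʳ [ x ] ⊆-refl

  x∉u : x ∉ u
  x∉u x∈u = Unmatched⇒¬Matched {u ++ [ x ]} x-unmatched (twice⇒Matched ot (++⁺ (from∈ x∈u) ⊆-refl))

  Matched⇒≢x : ∀ {e} → Matched (u ++ [ x ]) e → x ≢ e
  Matched⇒≢x m refl = Unmatched⇒¬Matched {u ++ [ x ]} x-unmatched m

  SameGraph-snoc : SameGraph (u ++ [ x ]) u
  SameGraph-snoc = record { matched = mk⇔ matched→ (Matched-⊆ ot u⊆u++[x]) ; arc = mk⇔ arc→ (Arc-⊆ ot u⊆u++[x]) }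
    where
    matched→ : ∀ {e} → Matched (u ++ [ x ]) e → Matched u e
    matched→ m = trans (sym (occ-++-[≢] u (Matched⇒≢x m))) m
    arc→ : ∀ {e f} → Arc (u ++ [ x ]) e f → Arc u e f
    arc→ {e} {f} (mₑ , m_f , σ) = matched→ mₑ , matched→ m_f ,
      ⊆-++⁻ˡ-∉last (e ∷ f ∷ e ∷ []) u (λ { (here refl) → Matched⇒≢x m_f refl }) σ

  NoSinkCoversUnmatched-snoc : NoSinkCoversUnmatched (u ++ [ x ]) ⇔ NoSinkCoversUnmatched u
  NoSinkCoversUnmatched-snoc = mk⇔ restrict extend
    where
    restrict : NoSinkCoversUnmatched (u ++ [ x ]) → NoSinkCoversUnmatched u
    restrict nc a b ua sb cov = nc a b (trans (occ-++-[≢] u x≢a) ua)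
      (Sink-transfer (SameGraph-sym SameGraph-snoc) sb) (⊆-trans cov u⊆u++[x])
      where
      x≢a : x ≢ a
      x≢a refl = x∉u (occ≡suc⇒∈ u ua)
    extend : NoSinkCoversUnmatched u → NoSinkCoversUnmatched (u ++ [ x ])
    extend nc a b ua sb cov with x ≟ a
    ... | yes refl = last-has-no-successor u x∉u (∷ˡ⁻ cov)
    ... | no x≢a = nc a b (trans (sym (occ-++-[≢] u x≢a)) ua) (Sink-transfer SameGraph-snoc sb)
      (⊆-++⁻ˡ-∉last (b ∷ a ∷ []) u (λ { (here refl) → Matched⇒≢x (proj₁ sb) refl }) cov)

  Q⇔snoc : Q (u ++ [ x ]) ⇔ IsDecomp (u ++ [ x ]) (snoc u x)
  Q⇔snoc = mk⇔
    (λ q → let (_ , dom , nc) = to Q⇔Q′ q in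
           refl , x-unmatched , from Q⇔Q′ (OneTwo-⊆ ot u⊆u++[x] , SinksDominate-transfer SameGraph-snoc dom ,
                                            to NoSinkCoversUnmatched-snoc nc))
    (λ (_ , _ , q) → let (_ , dom , nc) = to Q⇔Q′ q in
           from Q⇔Q′ (ot , SinksDominate-transfer (SameGraph-sym SameGraph-snoc) dom ,
                       from NoSinkCoversUnmatched-snoc nc))

-- The word w₁ x w₂ x

ff⊆efef : ∀ {e f : ℕ} → (f ∷ f ∷ []) ⊆ (e ∷ f ∷ e ∷ f ∷ [])
ff⊆efef {e} = e ∷ʳ refl ∷ e ∷ʳ refl ∷ []

module Wrap (w₁ : Word) (x : ℕ) (w₂ : Word) (ot : OneTwo (w₁ ++ x ∷ w₂ ++ [ x ])) where

  R : Word
  R = x ∷ w₂ ++ [ x ]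

  W : Word
  W = w₁ ++ R

  w₁⊆W : w₁ ⊆ W
  w₁⊆W = ++⁺ʳ R ⊆-refl

  R⊆W : R ⊆ W
  R⊆W = ++⁺ˡ w₁ ⊆-refl

  w₂⊆W : w₂ ⊆ W
  w₂⊆W = ⊆-trans (x ∷ʳ ++⁺ʳ [ x ] ⊆-refl) R⊆W

  x∉w₁ : x ∉ w₁
  x∉w₁ x∈w₁ = ¬thrice ot (++⁺ (from∈ x∈w₁) (refl ∷ ++⁺ˡ w₂ ⊆-refl))

  x∉w₂ : x ∉ w₂
  x∉w₂ x∈w₂ = ¬thrice ot (++⁺ˡ w₁ (refl ∷ ++⁺ (from∈ x∈w₂) ⊆-refl))

  ∈R⇒ : ∀ {a} → a ∈ R → a ≡ x ⊎ a ∈ w₂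
  ∈R⇒ (here refl) = inj₁ refl
  ∈R⇒ (there a∈) with ∈-++⁻ w₂ a∈
  ... | inj₁ a∈w₂ = inj₂ a∈w₂
  ... | inj₂ (here refl) = inj₁ refl

  x-matched : Matched W x
  x-matched = twice⇒Matched ot (++⁺ˡ w₁ (refl ∷ ++⁺ˡ w₂ ⊆-refl))

  x-sink : Sink W x
  x-sink = x-matched , λ f (_ , _ , σ) → noArc σ
    where
    noArc : ∀ {f} → ¬ (x ∷ f ∷ x ∷ f ∷ []) ⊆ W
    noArc σ with ⊆-++⁻ʳ-∉head w₁ x∉w₁ σ
    ... | _ ∷ʳ σ′ = last-has-no-successor w₂ x∉w₂ σ′
    ... | refl ∷ σ′ = last-has-no-successor w₂ x∉w₂ (∷ˡ⁻ σ′)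

  crossing⇒Arc : ∀ {c} → c ∈ w₁ → c ∈ w₂ → Arc W c x
  crossing⇒Arc c∈w₁ c∈w₂ = twice⇒Matched ot (⊆-trans (refl ∷ x ∷ʳ refl ∷ x ∷ʳ []) σ) , x-matched , σ
    where σ = ++⁺ (from∈ c∈w₁) (refl ∷ ++⁺ (from∈ c∈w₂) ⊆-refl)

  crossing⇒¬Sink : ∀ {c} → c ∈ w₁ → c ∈ w₂ → ¬ Sink W c
  crossing⇒¬Sink c∈w₁ c∈w₂ (_ , noArc) = noArc x (crossing⇒Arc c∈w₁ c∈w₂)

  inner∉w₁ : ∀ {e} → Matched w₂ e → e ∉ w₁
  inner∉w₁ m e∈w₁ = ¬thrice ot (++⁺ (from∈ e∈w₁) (x ∷ʳ ++⁺ʳ [ x ] (Matched⇒twice w₂ m)))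

  outer∉R : ∀ {e} → Matched w₁ e → e ∉ R
  outer∉R m e∈R = ¬thrice ot (++⁺ (Matched⇒twice w₁ m) (from∈ e∈R))

  data Position : ℕ → Set where
    last     : Position x
    inner    : ∀ {e} → Matched w₂ e → Position e
    crossing : ∀ {e} → e ∈ w₁ → e ∈ w₂ → Position e
    outer    : ∀ {e} → Matched w₁ e → Position e

  position : ∀ {e} → Matched W e → Position e
  position {e} m with Matched-++⁻ w₁ m
  ... | inj₁ m₁ = outer m₁
  ... | inj₂ (inj₁ (u₁ , u_R)) with ∈R⇒ (occ≡suc⇒∈ R u_R)
  ...   | inj₁ refl = ⊥-elim (x∉w₁ (occ≡suc⇒∈ w₁ u₁))
  ...   | inj₂ e∈w₂ = crossing (occ≡suc⇒∈ w₁ u₁) e∈w₂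
  position {e} m | inj₂ (inj₂ m_R) with x ≟ e
  ... | yes refl = last
  ... | no x≢e = inner (trans (sym (occ-++-[≢] w₂ x≢e)) m_R)

  Unmatched-w₁⇒∈R : ∀ {a} → Unmatched w₁ a → Matched W a → a ∈ R
  Unmatched-w₁⇒∈R {a} u₁ m with Matched-++⁻ w₁ m
  ... | inj₁ m₁ = ⊥-elim (Unmatched⇒¬Matched {w₁} u₁ m₁)
  ... | inj₂ (inj₁ (_ , u_R)) = occ≡suc⇒∈ R u_R
  ... | inj₂ (inj₂ m_R) = occ≡suc⇒∈ R m_R

  Arc-inner : ∀ {e f} → Matched w₂ e → Arc W e f → Arc w₂ e f
  Arc-inner {e} {f} m (_ , _ , σ) with ⊆-++⁻ʳ-∉head w₁ (inner∉w₁ m) σ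
  ... | refl ∷ _ = ⊥-elim (x∉w₂ (occ≡suc⇒∈ w₂ m))
  ... | _ ∷ʳ σ′ = m , twice⇒Matched (OneTwo-⊆ ot w₂⊆W) (⊆-trans ff⊆efef σ″) , σ″
    where
    f∉[x] : f ∉ [ x ]
    f∉[x] (here refl) = last-has-no-successor w₂ x∉w₂ (∷ˡ⁻ σ′)
    σ″ = ⊆-++⁻ˡ-∉last (e ∷ f ∷ e ∷ []) w₂ f∉[x] σ′

  Sink-inner : ∀ {e} → Matched w₂ e → Sink w₂ e → Sink W e
  Sink-inner m (_ , noArc) = Matched-⊆ ot w₂⊆W m , λ f → noArc f ∘ Arc-inner m

  Arc-outer : ∀ {e f} → Matched w₁ e → Arc W e f →
    Arc w₁ e f ⊎ (Unmatched w₁ f × f ∈ w₂ × Covers w₁ e f)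
  Arc-outer {e} {f} m (_ , _ , σ) with f ∈? R
  ... | no f∉R = inj₁ (m , twice⇒Matched (OneTwo-⊆ ot w₁⊆W) (⊆-trans ff⊆efef σ₁) , σ₁)
    where σ₁ = ⊆-++⁻ˡ-∉last (e ∷ f ∷ e ∷ []) w₁ f∉R σ
  ... | yes f∈R = inj₂ (unmatched , f∈w₂ , cov)
    where
    cov : Covers w₁ e f
    cov = ⊆-++⁻ˡ-∉last (e ∷ f ∷ []) w₁ (outer∉R m) (⊆-trans (refl ∷ refl ∷ refl ∷ f ∷ʳ []) σ)
    f∈w₁ = Any-resp-⊆ cov (there (here refl))
    f∈w₂ : f ∈ w₂
    f∈w₂ with ∈R⇒ f∈R
    ... | inj₁ refl = ⊥-elim (x∉w₁ f∈w₁)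
    ... | inj₂ f∈w₂ = f∈w₂
    unmatched : Unmatched w₁ f
    unmatched with OneTwo-⊆ ot w₁⊆W f f∈w₁
    ... | inj₁ u = u
    ... | inj₂ m_f = ⊥-elim (outer∉R m_f f∈R)

  NoUnmatchedIn-w₂ : Set
  NoUnmatchedIn-w₂ = ∀ b → Unmatched W b → b ∉ w₂

  restrict : Q′ W → NoUnmatchedIn-w₂ × SinksDominate w₂ × Q′ w₁
  restrict (_ , dom , nc) = noUnmatched , SinksDominate-restrict ot w₂⊆W reflect₂ dom ,
                            OneTwo-⊆ ot w₁⊆W , SinksDominate-restrict ot w₁⊆W reflect₁ dom , nc₁
    where
    noUnmatched : NoUnmatchedIn-w₂
    noUnmatched b u b∈w₂ = nc b x u x-sink (++⁺ˡ w₁ (refl ∷ ++⁺ (from∈ b∈w₂) ⊆-refl))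
    reflect₂ : ArcsToSinksReflect w₂ W
    reflect₂ m a _ = Arc-inner m a
    reflect₁ : ArcsToSinksReflect w₁ W
    reflect₁ m a s with Arc-outer m a
    ... | inj₁ a₁ = a₁
    ... | inj₂ (_ , f∈w₂ , cov) = ⊥-elim (crossing⇒¬Sink (Any-resp-⊆ cov (there (here refl))) f∈w₂ s)
    nc₁ : NoSinkCoversUnmatched w₁
    nc₁ a b u₁ s₁ cov with ot a (Any-resp-⊆ w₁⊆W (Any-resp-⊆ cov (there (here refl))))
    ... | inj₁ u = nc a b u (Sink-lift ot w₁⊆W reflect₁ dom s₁) (⊆-trans cov w₁⊆W)
    ... | inj₂ m = proj₂ (Sink-lift ot w₁⊆W reflect₁ dom s₁) a
                     (Matched-⊆ ot w₁⊆W (proj₁ s₁) , m , ++⁺ cov (from∈ (Unmatched-w₁⇒∈R u₁ m)))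

  extend : NoUnmatchedIn-w₂ → SinksDominate w₂ → Q′ w₁ → Q′ W
  extend noUnmatched dom₂ (_ , dom₁ , nc₁) = ot , dom , nc
    where
    Sink-outer : ∀ {e} → Sink w₁ e → Sink W e
    Sink-outer {e} (m , noArc) = Matched-⊆ ot w₁⊆W m , noArcW
      where
      noArcW : ∀ f → ¬ Arc W e f
      noArcW f a with Arc-outer m a
      ... | inj₁ a₁ = noArc f a₁
      ... | inj₂ (u , _ , cov) = nc₁ f e u (m , noArc) cov
    dom : SinksDominate W
    dom e m ¬sink with position m
    ... | last = ⊥-elim (¬sink x-sink)
    ... | inner m₂ = dominated-lift ot w₂⊆W (λ s → Sink-inner (proj₁ s) s) dom₂ m₂ ¬sink
    ... | crossing e∈w₁ e∈w₂ = x , crossing⇒Arc e∈w₁ e∈w₂ , x-sink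
    ... | outer m₁ = dominated-lift ot w₁⊆W Sink-outer dom₁ m₁ ¬sink
    ¬Covers-by-∉w₁ : ∀ {a b} → b ∉ w₁ → Unmatched W a → Covers W b a → ⊥
    ¬Covers-by-∉w₁ b∉w₁ u cov with ∈R⇒ (Any-resp-⊆ (⊆-++⁻ʳ-∉head w₁ b∉w₁ cov) (there (here refl)))
    ... | inj₁ refl = Unmatched⇒¬Matched {W} u x-matched
    ... | inj₂ a∈w₂ = noUnmatched _ u a∈w₂
    nc : NoSinkCoversUnmatched W
    nc a b u s cov with position (proj₁ s)
    ... | last = ¬Covers-by-∉w₁ x∉w₁ u cov
    ... | inner m₂ = ¬Covers-by-∉w₁ (inner∉w₁ m₂) u cov
    ... | crossing b∈w₁ b∈w₂ = crossing⇒¬Sink b∈w₁ b∈w₂ s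
    ... | outer m₁ =
      nc₁ a b (Unmatched-⊆ w₁⊆W u (Any-resp-⊆ cov₁ (there (here refl)))) (Sink-⊇ ot w₁⊆W s m₁) cov₁
      where cov₁ = ⊆-++⁻ˡ-∉last (b ∷ a ∷ []) w₁ (outer∉R m₁) cov

  Q⇔wrap : Q W ⇔ IsDecomp W (wrap w₁ x w₂)
  Q⇔wrap = mk⇔
    (λ q → let (noUnmatched , dom₂ , q₁) = restrict (to Q⇔Q′ q) in
           refl , noUnmatched , from (P-°⇔SinksDominate w₂) dom₂ , from Q⇔Q′ q₁)
    (λ (_ , noUnmatched , p₂ , q₁) →
           from Q⇔Q′ (extend noUnmatched (to (P-°⇔SinksDominate w₂) p₂) (to Q⇔Q′ q₁)))

-- Existence and uniqueness of the decomposition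

Q[] : Q []
Q[] = (λ _ ()) , ((λ _ ()) , λ _ ()) , λ _ _ ()

Matched-last⇒∈init : ∀ u {x} → Matched (u ++ [ x ]) x → x ∈ u
Matched-last⇒∈init u {x} m with x ∈? u
... | yes x∈u = x∈u
... | no x∉u = ⊥-elim (last-has-no-successor u x∉u (Matched⇒twice (u ++ [ x ]) m))

wrap-as-snoc : ∀ w₁ (x : ℕ) w₂ → w₁ ++ x ∷ w₂ ++ [ x ] ≡ (w₁ ++ x ∷ w₂) ++ [ x ]
wrap-as-snoc w₁ x w₂ = sym (++-assoc w₁ (x ∷ w₂) [ x ])

decomposition⇒Q : ∀ {w} → OneTwo w → ∀ s → IsDecomp w s → Q w
decomposition⇒Q ot empty refl = Q[]
decomposition⇒Q ot (snoc u x) d@(refl , ux , _) = from (Snoc.Q⇔snoc u x ot ux) d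
decomposition⇒Q ot (wrap w₁ x w₂) d@(refl , _) = from (Wrap.Q⇔wrap w₁ x w₂ ot) d

Q⇒decomposition : ∀ {w} → Reverse w → OneTwo w → Q w → ∃[ s ] IsDecomp w s
Q⇒decomposition [] _ _ = empty , refl
Q⇒decomposition (u ∶ _ ∶ʳ x) ot q with ot x (∈-++⁺ʳ u (here refl))
... | inj₁ ux = snoc u x , to (Snoc.Q⇔snoc u x ot ux) q
... | inj₂ mx with ∈-∃++ (Matched-last⇒∈init u mx)
... | w₁ , w₂ , refl = subst (λ v → ∃[ s ] IsDecomp v s) (wrap-as-snoc w₁ x w₂)
        (wrap w₁ x w₂ , to (Wrap.Q⇔wrap w₁ x w₂ ot′) (subst Q (sym (wrap-as-snoc w₁ x w₂)) q))
  where ot′ = subst OneTwo (sym (wrap-as-snoc w₁ x w₂)) ot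

∉⇒++-∷-injective : ∀ {x : ℕ} us vs {ys zs} → x ∉ us → x ∉ vs →
  us ++ x ∷ ys ≡ vs ++ x ∷ zs → us ≡ vs × ys ≡ zs
∉⇒++-∷-injective [] [] _ _ refl = refl , refl
∉⇒++-∷-injective [] (_ ∷ _) _ x∉vs refl = ⊥-elim (x∉vs (here refl))
∉⇒++-∷-injective (_ ∷ _) [] x∉us _ refl = ⊥-elim (x∉us (here refl))
∉⇒++-∷-injective (_ ∷ us) (_ ∷ vs) x∉us x∉vs eq with ∷-injective eq
... | refl , eq′ with ∉⇒++-∷-injective us vs (x∉us ∘ there) (x∉vs ∘ there) eq′
... | refl , refl = refl , refl

empty-unique : ∀ {w} t → IsDecomp w empty → IsDecomp w t → empty ≡ t
empty-unique empty _ _ = refl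
empty-unique (snoc u _) refl (eq , _) with ++-conicalʳ u _ (sym eq)
... | ()
empty-unique (wrap w₁ x w₂) refl (eq , _)
  with ++-conicalʳ (w₁ ++ x ∷ w₂) _ (sym (trans eq (wrap-as-snoc w₁ x w₂)))
... | ()

snoc-wrap-disjoint : ∀ {w u a w₁ b w₂} → OneTwo w → IsDecomp w (snoc u a) → ¬ IsDecomp w (wrap w₁ b w₂)
snoc-wrap-disjoint {u = u} {a} {w₁} {b} {w₂} ot (refl , ua , _) (eq , _)
  with ∷ʳ-injective u (w₁ ++ b ∷ w₂) (trans eq (wrap-as-snoc w₁ b w₂))
... | _ , refl = Unmatched⇒¬Matched {u ++ [ a ]} ua
                   (subst (λ v → Matched v a) (sym eq) (Wrap.x-matched w₁ a w₂ (subst OneTwo eq ot)))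

decomposition-unique : ∀ {w} → OneTwo w → ∀ s t → IsDecomp w s → IsDecomp w t → s ≡ t
decomposition-unique ot empty t d e = empty-unique t d e
decomposition-unique ot s empty d e = sym (empty-unique s e d)
decomposition-unique ot (snoc u a) (snoc v b) (refl , _) (eq , _) with ∷ʳ-injective u v eq
... | refl , refl = refl
decomposition-unique ot (snoc _ _) (wrap _ _ _) d e = ⊥-elim (snoc-wrap-disjoint ot d e)
decomposition-unique ot (wrap _ _ _) (snoc _ _) d e = ⊥-elim (snoc-wrap-disjoint ot e d)
decomposition-unique ot (wrap w₁ a w₂) (wrap v₁ b v₂) (refl , _) (eq , _)
  with ∷ʳ-injective (w₁ ++ a ∷ w₂) (v₁ ++ b ∷ v₂)
         (trans (sym (wrap-as-snoc w₁ a w₂)) (trans eq (wrap-as-snoc v₁ b v₂)))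
... | eq′ , refl with ∉⇒++-∷-injective w₁ v₁ (Wrap.x∉w₁ w₁ a w₂ ot) (Wrap.x∉w₁ v₁ a v₂ (subst OneTwo eq ot)) eq′
... | refl , refl = refl

lemma18 : (w : Word) → OneTwo w →
    (Q w ⇔ (∃[ s ] IsDecomp w s)) ×
    (∀ s t → IsDecomp w s → IsDecomp w t → s ≡ t)
lemma18 w ot =
  mk⇔ (Q⇒decomposition (reverseView w) ot) (λ (s , d) → decomposition⇒Q ot s d) ,
  decomposition-unique ot
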